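{- Let $G$ be a $d$-degenerate graph on the vertex set $[n]$. Then $e(G)\le\tau(G,n)\le\tau_{\text{lab}}(G,n)\le dn$. In particular, if $e(G)=dn$ then $\tau(G,n)=\tau_{\text{lab}}(G,n)=dn$; and if $T$ is a tree on $[n]$ then $n-1\le\tau(T,n)\le\tau_{\text{lab}}(T,n)\le n$.
   Context: Semi-random no-replacement multigraph process on $[n]=\{1,\dots,n\}$: let $\pi_1,\pi_2,\dots$ be independent uniformly random permutations in $S_n$. Builder's multigraph starts empty on $[n]$. In round $k\ge1$ Builder is offered the vertex $v_k:=\pi_{\lceil k/n\rceil}(k-\lfloor (k-1)/n\rfloor n)$; Builder then chooses a vertex $u_k$ according to his strategy (a rule depending on the history so far) and adds the edge $u_kv_k$ (multiple edges allowed). For a labeled graph $G$ on $[n]$ and a strategy $\mathcal S$, let $\tau(\mathcal S)$ be the least $m$ such that Builder's multigraph after $m$ rounds contains $G$ (resp. some graph isomorphic to $G$) as a subgraph; $\tau_{\text{lab}}(G,n)$ (resp. $\tau(G,n)$) is a random variable with $\Pr(\cdot\le k)=\max_{\mathcal S}\Pr(\tau(\mathcal S)\le k)$ for all $k\ge0$, coupled so that $\tau(G,n)\le\tau_{\text{lab}}(G,n)$. $e(G)$ is the number of edges. -}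

module Defs where

open import Data.Nat using (ℕ; zero; suc; _+_; _*_; _≤_; _<_; _<ᵇ_; NonZero)
open import Data.Nat.DivMod using (_/_; _%_; m%n<n)
open import Data.Bool using (Bool; true; false; if_then_else_; _∧_)
open import Data.Fin using (Fin; toℕ; fromℕ<)
open import Data.Fin.Subset using (Subset; _∈_; Nonempty)
open import Data.Fin.Permutation using (Permutation′; _⟨$⟩ʳ_)
open import Data.List using (List; []; _∷_; length; map; allFin; _∷ʳ_)
open import Data.Nat.ListAction using (sum)
open import Data.List.Relation.Unary.Unique.Propositional using (Unique)
import Data.List.Membership.Propositional as LM
open import Data.Vec using (lookup)
open import Data.Product using (_×_; _,_; Σ; ∃)
open import Data.Sum using (_⊎_)
open import Data.Unit using (⊤)
open import Function.Definitions using (Injective)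
open import Relation.Binary.PropositionalEquality using (_≡_)

record Graph (n : ℕ) : Set where
  field
    adj    : Fin n → Fin n → Bool
    sym    : ∀ x y → adj x y ≡ adj y x
    irrefl : ∀ x → adj x x ≡ false
open Graph public

e : ∀ {n} → Graph n → ℕ
e {n} G = sum (map (λ x → sum (map (λ y →
            if (toℕ x <ᵇ toℕ y) ∧ adj G x y then 1 else 0) (allFin n))) (allFin n))

degIn : ∀ {n} → Graph n → Subset n → Fin n → ℕ
degIn {n} G S v = sum (map (λ y → if lookup S y ∧ adj G v y then 1 else 0) (allFin n))

Degenerate : ∀ {n} → ℕ → Graph n → Set
Degenerate {n} d G = (S : Subset n) → Nonempty S → ∃ λ v → v ∈ S × degIn G S v ≤ d

data Walk {n} (G : Graph n) : Fin n → Fin n → Set where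
  here : ∀ {x} → Walk G x x
  step : ∀ {x y z} → adj G x y ≡ true → Walk G y z → Walk G x z

Connected : ∀ {n} → Graph n → Set
Connected {n} G = (x y : Fin n) → Walk G x y

AdjChain : ∀ {n} → Graph n → List (Fin n) → Set
AdjChain G []           = ⊤
AdjChain G (x ∷ [])     = ⊤
AdjChain G (x ∷ y ∷ r)  = adj G x y ≡ true × AdjChain G (y ∷ r)

HasCycle : ∀ {n} → Graph n → Set
HasCycle {n} G = Σ (Fin n) λ v → Σ (List (Fin n)) λ ws →
  2 ≤ length ws × Unique (v ∷ ws) × AdjChain G ((v ∷ ws) ∷ʳ v)

IsTree : ∀ {n} → Graph n → Set
IsTree G = Connected G × (HasCycle G → Data.Empty.⊥)
  where import Data.Empty

-- history: list of rounds (v_i , u_i), most recent first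
History : ℕ → Set
History n = List (Fin n × Fin n)

Strategy : ℕ → Set
Strategy n = History n → Fin n → Fin n

-- an outcome: the sequence π₁, π₂, … of permutations (0-indexed here)
PermSeq : ℕ → Set
PermSeq n = ℕ → Permutation′ n

-- vertex offered in round i+1 (i = 0,1,…): π_{⌈(i+1)/n⌉}((i mod n) + 1)
offered : ∀ {n} .{{_ : NonZero n}} → PermSeq n → ℕ → Fin n
offered {n} π i = π (i / n) ⟨$⟩ʳ fromℕ< (m%n<n i n)

-- Builder's multigraph after m rounds (edge list, with multiplicity)
history : ∀ {n} .{{_ : NonZero n}} → Strategy n → PermSeq n → ℕ → History n
history S π zero    = []
history S π (suc m) = (offered π m , S (history S π m) (offered π m)) ∷ history S π m

HasEdge : ∀ {n} → History n → Fin n → Fin n → Set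
HasEdge E x y = (x , y) LM.∈ E ⊎ (y , x) LM.∈ E

ContainsLab : ∀ {n} → Graph n → History n → Set
ContainsLab {n} G E = (x y : Fin n) → adj G x y ≡ true → HasEdge E x y

ContainsCopy : ∀ {n} → Graph n → History n → Set
ContainsCopy {n} G E = Σ (Fin n → Fin n) λ σ → Injective _≡_ _≡_ σ ×
  ((x y : Fin n) → adj G x y ≡ true → HasEdge E (σ x) (σ y))

-- "Pr(τ_lab(G,n) ≤ k) = 1": some strategy builds G (labeled) within k
-- rounds for every outcome of the permutations
LabWithinSurely : ∀ {n} .{{_ : NonZero n}} → Graph n → ℕ → Set
LabWithinSurely {n} G k =
  Σ (Strategy n) λ S → (π : PermSeq n) → ContainsLab G (history S π k)

-- "Pr(τ(G,n) ≤ k) = 0": no strategy ever has a copy of G after k rounds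
CopyWithinNever : ∀ {n} .{{_ : NonZero n}} → Graph n → ℕ → Set
CopyWithinNever {n} G k =
  (S : Strategy n) (π : PermSeq n) → ContainsCopy G (history S π k) → Data.Empty.⊥
  where import Data.Empty

-- Lower bounds: each round adds one edge, so a copy of G needs e(G) rounds; a connected graph has
-- at least n − 1 edges, since sending every vertex other than a root r to the edge towards a
-- neighbour strictly closer to r is injective.
-- Upper bound: a d-degenerate graph has an orientation with all out-degrees at most d (peel off a
-- vertex of degree at most d and orient its edges away from it). Each permutation offers every vertex
-- exactly once, so if Builder joins the vertex offered during the j-th permutation to its j-th
-- out-neighbour, all of G is present after d permutations, i.e. dn rounds. A tree is 1-degenerate:
-- in a vertex set where every vertex has two neighbours, a maximal path closes into a cycle.

module Submission where

open import Data.Bool using (Bool; true; false; T; _∧_; if_then_else_)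
import Data.Bool as Bool
open import Data.Bool.Properties using (T?; T-∧; T-≡)
open import Data.Empty using (⊥-elim)
open import Data.Fin using (Fin; toℕ; fromℕ<; _≟_)
open import Data.Fin.Properties using (toℕ-fromℕ<; toℕ-injective; toℕ<n; any?)
open import Data.Fin.Permutation using (_⟨$⟩ʳ_; _⟨$⟩ˡ_; inverseʳ)
open import Data.Fin.Subset using (Subset; ⊤; _-_; _⊂_) renaming (_∈_ to _∈ₛ_)
open import Data.Fin.Subset.Properties using (∈⊤; x∈p∧x≢y⇒x∈p-y; x∈p⇒p-x⊂p; nonempty?) renaming (_∈?_ to _∈ₛ?_)
open import Data.Fin.Subset.Induction using (⊂-wellFounded)
open import Data.List using (List; []; _∷_; [_]; _++_; _∷ʳ_; length; map; filter; cartesianProduct; allFin)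
open import Data.List.Properties using (length-map; length-++; length-tabulate; length-removeAt′; filter-++; map-∘; ++-assoc)
open import Data.List.Membership.Propositional using (_∈_; _∉_; find)
open import Data.List.Membership.Propositional.Properties using (∈-filter⁺; ∈-filter⁻; ∈-cartesianProduct⁺; ∈-allFin; ∈-map⁺; ∈-∃++)
import Data.List.Membership.DecPropositional as DecMembership
open import Data.List.Relation.Unary.Any using (here; there; _─_)
open import Data.List.Relation.Unary.All using (All; []; _∷_; all?)
import Data.List.Relation.Unary.All as All
open import Data.List.Relation.Unary.All.Properties using (¬Any⇒All¬; ¬All⇒Any¬; ++⁻ˡ)
open import Data.List.Relation.Unary.Unique.Propositional using (Unique; []; _∷_)
open import Data.List.Relation.Unary.Unique.Propositional.Properties using (filter⁺; cartesianProduct⁺; allFin⁺; Unique[x∷xs]⇒x∉xs)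
open import Data.Maybe using (Maybe; just; nothing)
open import Data.Maybe.Properties using (just-injective)
open import Data.Nat using (ℕ; zero; suc; _+_; _*_; _∸_; _<_; _≤_; _≤′_; ≤′-refl; ≤′-step; z≤n; s≤s; _<ᵇ_; _<?_; _≤?_; NonZero)
open import Data.Nat.Properties using (<ᵇ⇒<; <⇒<ᵇ; <-asym; ≮⇒≥; ≤-antisym; <-cmp; <⇒≱; ≰⇒>; ≤-trans; <-≤-trans; ≤⇒≤′; +-monoˡ-<; *-monoˡ-≤; ∸-monoˡ-≤; +-identityʳ; +-suc; *-identityˡ; n<1+n; module ≤-Reasoning)
open import Data.Nat.DivMod using (_/_; _%_; m%n<n; m<n⇒m/n≡0; m*n/n≡m; +-distrib-/-∣ʳ; [m+kn]%n≡m%n; m<n⇒m%n≡m)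
open import Data.Nat.Divisibility using (n∣m*n)
open import Data.Nat.ListAction using (sum)
open import Data.Product using (_×_; _,_; ∃; proj₁; proj₂; swap; uncurry)
open import Data.Sum using (_⊎_; inj₁; inj₂; [_,_]′)
open import Data.Unit using (tt)
open import Data.Vec using (lookup)
open import Data.Vec.Properties using ([]=⇒lookup; lookup⇒[]=)
open import Function using (_∘_)
open import Function.Bundles using (Equivalence)
open import Induction.WellFounded using (Acc; acc)
open import Relation.Binary.Definitions using (DecidableEquality; tri<; tri≈; tri>)
open import Relation.Nullary using (¬_; yes; no)
open import Relation.Nullary.Decidable using (_×-dec_)
open import Relation.Unary using (Decidable)
open import Relation.Binary.PropositionalEquality using (_≡_; _≢_; refl; sym; trans; cong; cong₂; subst; module ≡-Reasoning)
open import Defs renaming (sym to adj-sym)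

module _ {A : Set} where

  nthOr : A → List A → ℕ → A
  nthOr d []       _       = d
  nthOr d (x ∷ xs) zero    = x
  nthOr d (x ∷ xs) (suc j) = nthOr d xs j

  ∈⇒nthOr : ∀ {d y} {xs : List A} → y ∈ xs → ∃ λ j → j < length xs × nthOr d xs j ≡ y
  ∈⇒nthOr (here refl) = 0 , s≤s z≤n , refl
  ∈⇒nthOr (there y∈xs) with j , j<len , eq ← ∈⇒nthOr y∈xs = suc j , s≤s j<len , eq

  length-∷ʳ≥1 : ∀ (xs : List A) x → 1 ≤ length (xs ∷ʳ x)
  length-∷ʳ≥1 []       _ = s≤s z≤n
  length-∷ʳ≥1 (_ ∷ _)  _ = s≤s z≤n

  ∈-─⁺ : ∀ {z w} {ys : List A} → z ∈ ys → (w∈ys : w ∈ ys) → z ≢ w → z ∈ (ys ─ w∈ys)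
  ∈-─⁺ (here refl) (here refl) z≢w = ⊥-elim (z≢w refl)
  ∈-─⁺ (there z∈)  (here _)    _   = z∈
  ∈-─⁺ (here z≡y)  (there _)   _   = here z≡y
  ∈-─⁺ (there z∈)  (there w∈)  z≢w = there (∈-─⁺ z∈ w∈ z≢w)

  Unique-++⁻ˡ : ∀ xs {ys : List A} → Unique (xs ++ ys) → Unique xs
  Unique-++⁻ˡ []       _          = []
  Unique-++⁻ˡ (x ∷ xs) (x∉ ∷ uniq) = ++⁻ˡ xs x∉ ∷ Unique-++⁻ˡ xs uniq

  Unique⇒∃≢ : DecidableEquality A → ∀ {xs} → Unique xs → 2 ≤ length xs → ∀ w → ∃ λ y → y ∈ xs × y ≢ w
  Unique⇒∃≢ _≟ᴬ_ {x ∷ y ∷ _} ((x≢y ∷ _) ∷ _) _ w with x ≟ᴬ w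
  ... | yes refl = y , there (here refl) , x≢y ∘ sym
  ... | no  x≢w  = x , here refl , x≢w
  Unique⇒∃≢ _ {_ ∷ []} _ (s≤s ())

module _ {A B : Set} where

  length-≤-injection : (f : A → B) {xs : List A} {ys : List B} → Unique xs →
    (∀ {x} → x ∈ xs → f x ∈ ys) →
    (∀ {x x′} → x ∈ xs → x′ ∈ xs → f x ≡ f x′ → x ≡ x′) →
    length xs ≤ length ys
  length-≤-injection f {[]}     _    _    _     = z≤n
  length-≤-injection f {x ∷ xs} {ys} uniq@(_ ∷ uniq′) f∈ f-inj = begin
    suc (length xs)         ≤⟨ s≤s (length-≤-injection f uniq′ f∈′ λ p q → f-inj (there p) (there q)) ⟩
    suc (length (ys ─ fx∈)) ≡⟨ length-removeAt′ ys _ ⟨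
    length ys               ∎
    where
    open ≤-Reasoning
    fx∈ : f x ∈ ys
    fx∈ = f∈ (here refl)
    f∈′ : ∀ {z} → z ∈ xs → f z ∈ (ys ─ fx∈)
    f∈′ z∈ = ∈-─⁺ (f∈ (there z∈)) fx∈ λ fz≡fx →
      Unique[x∷xs]⇒x∉xs uniq (subst (_∈ xs) (f-inj (there z∈) (here refl) fz≡fx) z∈)

Unique⇒length≤ : ∀ {n} {xs : List (Fin n)} → Unique xs → length xs ≤ n
Unique⇒length≤ {n} {xs} uniq = subst (length xs ≤_) (length-tabulate {n = n} (λ x → x))
  (length-≤-injection (λ x → x) uniq (λ {x} _ → ∈-allFin x) (λ _ _ eq → eq))

true≢false : true ≢ false
true≢false ()

sum-indicator≡length-filter : ∀ {A : Set} (b : A → Bool) (xs : List A) →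
  sum (map (λ x → if b x then 1 else 0) xs) ≡ length (filter (T? ∘ b) xs)
sum-indicator≡length-filter b []       = refl
sum-indicator≡length-filter b (x ∷ xs) with b x
... | true  = cong suc (sum-indicator≡length-filter b xs)
... | false = sum-indicator≡length-filter b xs

module _ {A B : Set} where

  sum-sum-indicator≡length-filter : (b : A → B → Bool) (xs : List A) (ys : List B) →
    sum (map (λ x → sum (map (λ y → if b x y then 1 else 0) ys)) xs) ≡
    length (filter (T? ∘ uncurry b) (cartesianProduct xs ys))
  sum-sum-indicator≡length-filter b []       ys = refl
  sum-sum-indicator≡length-filter b (x ∷ xs) ys = begin
    sum (map (indicator ∘ (x ,_)) ys) + _
      ≡⟨ cong₂ _+_ (cong sum (map-∘ ys)) (sum-sum-indicator≡length-filter b xs ys) ⟩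
    sum (map indicator (map (x ,_) ys)) + length (filter Q (cartesianProduct xs ys))
      ≡⟨ cong (_+ length (filter Q (cartesianProduct xs ys))) (sum-indicator≡length-filter (uncurry b) (map (x ,_) ys)) ⟩
    length (filter Q (map (x ,_) ys)) + length (filter Q (cartesianProduct xs ys))
      ≡⟨ length-++ (filter Q (map (x ,_) ys)) ⟨
    length (filter Q (map (x ,_) ys) ++ filter Q (cartesianProduct xs ys))
      ≡⟨ cong length (filter-++ Q (map (x ,_) ys) (cartesianProduct xs ys)) ⟨
    length (filter Q (map (x ,_) ys ++ cartesianProduct xs ys)) ∎
    where
    open ≡-Reasoning
    indicator : A × B → ℕ
    indicator p = if uncurry b p then 1 else 0
    Q : Decidable (T ∘ uncurry b)
    Q = T? ∘ uncurry b

module _ {n : ℕ} where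

  ascending : Graph n → Fin n → Fin n → Bool
  ascending G x y = (toℕ x <ᵇ toℕ y) ∧ adj G x y

  edges : Graph n → List (Fin n × Fin n)
  edges G = filter (T? ∘ uncurry (ascending G)) (cartesianProduct (allFin n) (allFin n))

  e≡length-edges : (G : Graph n) → e G ≡ length (edges G)
  e≡length-edges G = sum-sum-indicator≡length-filter (ascending G) (allFin n) (allFin n)

  edges-unique : (G : Graph n) → Unique (edges G)
  edges-unique G = filter⁺ (T? ∘ uncurry (ascending G)) (cartesianProduct⁺ (allFin⁺ n) (allFin⁺ n))

  ∈-edges⁻ : (G : Graph n) {x y : Fin n} → (x , y) ∈ edges G → toℕ x < toℕ y × adj G x y ≡ true
  ∈-edges⁻ G {x} {y} xy∈
    with x<ᵇy , xy ← Equivalence.to T-∧ (proj₂ (∈-filter⁻ (T? ∘ uncurry (ascending G))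
                       {xs = cartesianProduct (allFin n) (allFin n)} xy∈)) =
    <ᵇ⇒< (toℕ x) (toℕ y) x<ᵇy , Equivalence.to T-≡ xy

  ∈-edges⁺ : (G : Graph n) {x y : Fin n} → toℕ x < toℕ y → adj G x y ≡ true → (x , y) ∈ edges G
  ∈-edges⁺ G {x} {y} x<y xy = ∈-filter⁺ (T? ∘ uncurry (ascending G))
    (∈-cartesianProduct⁺ (∈-allFin x) (∈-allFin y))
    (Equivalence.from T-∧ (<⇒<ᵇ x<y , Equivalence.from T-≡ xy))

  sortPair : Fin n × Fin n → Fin n × Fin n
  sortPair (x , y) with toℕ x <? toℕ y
  ... | yes _ = (x , y)
  ... | no  _ = (y , x)

  sortPair≡id⊎swap : ∀ p → sortPair p ≡ p ⊎ sortPair p ≡ swap p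
  sortPair≡id⊎swap (x , y) with toℕ x <? toℕ y
  ... | yes _ = inj₁ refl
  ... | no  _ = inj₂ refl

  sortPair-swap : ∀ p → sortPair (swap p) ≡ sortPair p
  sortPair-swap (x , y) with toℕ y <? toℕ x | toℕ x <? toℕ y
  ... | yes y<x | yes x<y = ⊥-elim (<-asym y<x x<y)
  ... | yes _   | no  _   = refl
  ... | no  _   | yes _   = refl
  ... | no  y≮x | no  x≮y with refl ← toℕ-injective (≤-antisym (≮⇒≥ y≮x) (≮⇒≥ x≮y)) = refl

  sortPair-injective : ∀ p q → sortPair p ≡ sortPair q → p ≡ q ⊎ p ≡ swap q
  sortPair-injective p q eq with sortPair≡id⊎swap p | sortPair≡id⊎swap q
  ... | inj₁ sp≡p | inj₁ sq≡q = inj₁ (trans (sym sp≡p) (trans eq sq≡q))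
  ... | inj₁ sp≡p | inj₂ sq≡q = inj₂ (trans (sym sp≡p) (trans eq sq≡q))
  ... | inj₂ sp≡p | inj₁ sq≡q = inj₂ (cong swap (trans (sym sp≡p) (trans eq sq≡q)))
  ... | inj₂ sp≡p | inj₂ sq≡q = inj₁ (cong swap (trans (sym sp≡p) (trans eq sq≡q)))

  sortPair-∈-edges : (G : Graph n) {x y : Fin n} → adj G x y ≡ true → sortPair (x , y) ∈ edges G
  sortPair-∈-edges G {x} {y} xy with toℕ x <? toℕ y | <-cmp (toℕ x) (toℕ y)
  ... | yes x<y | _           = ∈-edges⁺ G x<y xy
  ... | no  x≮y | tri< x<y _ _ = ⊥-elim (x≮y x<y)
  ... | no  _   | tri> _ _ y<x = ∈-edges⁺ G y<x (trans (adj-sym G y x) xy)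
  ... | no  _   | tri≈ _ x≡y _ with refl ← toℕ-injective x≡y = ⊥-elim (true≢false (trans (sym xy) (irrefl G x)))

  ContainsCopy⇒e≤length : (G : Graph n) (E : History n) → ContainsCopy G E → e G ≤ length E
  ContainsCopy⇒e≤length G E (σ , σ-injective , σ-embeds) = begin
    e G                       ≡⟨ e≡length-edges G ⟩
    length (edges G)          ≤⟨ length-≤-injection image (edges-unique G) image∈ image-injective ⟩
    length (map sortPair E)   ≡⟨ length-map sortPair E ⟩
    length E                  ∎
    where
    open ≤-Reasoning
    image : Fin n × Fin n → Fin n × Fin n
    image (x , y) = sortPair (σ x , σ y)
    image∈ : ∀ {p} → p ∈ edges G → image p ∈ map sortPair E
    image∈ {x , y} xy∈ with σ-embeds x y (proj₂ (∈-edges⁻ G xy∈))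
    ... | inj₁ σxy∈ = ∈-map⁺ sortPair σxy∈
    ... | inj₂ σyx∈ = subst (_∈ map sortPair E) (sortPair-swap (σ x , σ y)) (∈-map⁺ sortPair σyx∈)
    image-injective : ∀ {p q} → p ∈ edges G → q ∈ edges G → image p ≡ image q → p ≡ q
    image-injective {x , y} {x′ , y′} p∈ q∈ eq with sortPair-injective _ _ eq
    ... | inj₁ same = cong₂ _,_ (σ-injective (cong proj₁ same)) (σ-injective (cong proj₂ same))
    ... | inj₂ swapped with refl ← σ-injective (cong proj₁ swapped) | refl ← σ-injective (cong proj₂ swapped) =
      ⊥-elim (<-asym (proj₁ (∈-edges⁻ G p∈)) (proj₁ (∈-edges⁻ G q∈)))

record Orientation {n : ℕ} (d : ℕ) (G : Graph n) (S : Subset n) : Set where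
  field
    out        : Fin n → List (Fin n)
    out-length : ∀ x → length (out x) ≤ d
    covers     : ∀ {x y} → x ∈ₛ S → y ∈ₛ S → adj G x y ≡ true → y ∈ out x ⊎ x ∈ out y

module _ {n : ℕ} (G : Graph n) where

  neighbours : Subset n → Fin n → List (Fin n)
  neighbours S v = filter (λ y → T? (lookup S y ∧ adj G v y)) (allFin n)

  degIn≡length-neighbours : ∀ S v → degIn G S v ≡ length (neighbours S v)
  degIn≡length-neighbours S v = sum-indicator≡length-filter (λ y → lookup S y ∧ adj G v y) (allFin n)

  neighbours-unique : ∀ S v → Unique (neighbours S v)
  neighbours-unique S v = filter⁺ (λ y → T? (lookup S y ∧ adj G v y)) (allFin⁺ n)

  ∈-neighbours⁺ : ∀ {S v y} → y ∈ₛ S → adj G v y ≡ true → y ∈ neighbours S v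
  ∈-neighbours⁺ {S} {v} {y} y∈S vy = ∈-filter⁺ (λ y → T? (lookup S y ∧ adj G v y)) (∈-allFin y)
    (Equivalence.from T-∧ (Equivalence.from T-≡ ([]=⇒lookup y∈S) , Equivalence.from T-≡ vy))

  ∈-neighbours⁻ : ∀ {S v y} → y ∈ neighbours S v → y ∈ₛ S × adj G v y ≡ true
  ∈-neighbours⁻ {S} {v} {y} y∈
    with y∈S , vy ← Equivalence.to T-∧ (proj₂ (∈-filter⁻ (λ y → T? (lookup S y ∧ adj G v y)) {xs = allFin n} y∈)) =
    lookup⇒[]= y S (Equivalence.to T-≡ y∈S) , Equivalence.to T-≡ vy

  ∉-neighbours-self : ∀ S {v} → v ∉ neighbours S v
  ∉-neighbours-self S {v} v∈ = true≢false (trans (sym (proj₂ (∈-neighbours⁻ {S} v∈))) (irrefl G v))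

  module _ {d : ℕ} where

    extend-orientation : ∀ {S v} → v ∈ₛ S → degIn G S v ≤ d → Orientation d G (S - v) → Orientation d G S
    extend-orientation {S} {v} v∈S deg≤d o = record { out = out′ ; out-length = out′-length ; covers = covers′ }
      where
      open Orientation o
      out′ : Fin n → List (Fin n)
      out′ x with x ≟ v
      ... | yes _ = neighbours S v
      ... | no  _ = out x
      out′-length : ∀ x → length (out′ x) ≤ d
      out′-length x with x ≟ v
      ... | yes _ = subst (_≤ d) (degIn≡length-neighbours S v) deg≤d
      ... | no  _ = out-length x
      covers′ : ∀ {x y} → x ∈ₛ S → y ∈ₛ S → adj G x y ≡ true → y ∈ out′ x ⊎ x ∈ out′ y
      covers′ {x} {y} x∈S y∈S xy with x ≟ v | y ≟ v
      ... | yes refl | _        = inj₁ (∈-neighbours⁺ y∈S xy)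
      ... | no  _    | yes refl = inj₂ (∈-neighbours⁺ x∈S (trans (adj-sym G y x) xy))
      ... | no  x≢v  | no  y≢v  = covers (x∈p∧x≢y⇒x∈p-y x∈S x≢v) (x∈p∧x≢y⇒x∈p-y y∈S y≢v) xy

    degenerate⇒orientation : Degenerate d G → (S : Subset n) → Orientation d G S
    degenerate⇒orientation degenerate S = go S (⊂-wellFounded S)
      where
      go : (S : Subset n) → Acc _⊂_ S → Orientation d G S
      go S (acc smaller) with nonempty? S
      ... | no empty = record { out = λ _ → [] ; out-length = λ _ → z≤n ; covers = λ x∈S _ _ → ⊥-elim (empty (_ , x∈S)) }
      ... | yes nonempty with v , v∈S , deg≤d ← degenerate S nonempty =
        extend-orientation v∈S deg≤d (go (S - v) (smaller (x∈p⇒p-x⊂p v∈S)))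

module _ {n : ℕ} .{{_ : NonZero n}} where

  length-history : (S : Strategy n) (π : PermSeq n) (m : ℕ) → length (history S π m) ≡ m
  length-history S π zero    = refl
  length-history S π (suc m) = cong suc (length-history S π m)

  ∈-history-mono : (S : Strategy n) (π : PermSeq n) {m m′ : ℕ} {p : Fin n × Fin n} →
    m ≤′ m′ → p ∈ history S π m → p ∈ history S π m′
  ∈-history-mono S π ≤′-refl        p∈ = p∈
  ∈-history-mono S π (≤′-step m≤m′) p∈ = there (∈-history-mono S π m≤m′ p∈)

  <e⇒CopyWithinNever : (G : Graph n) (k : ℕ) → k < e G → CopyWithinNever G k
  <e⇒CopyWithinNever G k k<e S π copy = <⇒≱ k<e (begin
    e G                      ≤⟨ ContainsCopy⇒e≤length G _ copy ⟩
    length (history S π k)   ≡⟨ length-history S π k ⟩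
    k                        ∎)
    where open ≤-Reasoning

  -- The round, counted from 0, in which the j-th permutation offers x.
  visit : PermSeq n → ℕ → Fin n → ℕ
  visit π j x = toℕ (π j ⟨$⟩ˡ x) + j * n

  visit/n≡ : (π : PermSeq n) (j : ℕ) (x : Fin n) → visit π j x / n ≡ j
  visit/n≡ π j x = begin
    (r + j * n) / n      ≡⟨ +-distrib-/-∣ʳ r (n∣m*n j) ⟩
    r / n + j * n / n    ≡⟨ cong₂ _+_ (m<n⇒m/n≡0 (toℕ<n (π j ⟨$⟩ˡ x))) (m*n/n≡m j n) ⟩
    j                    ∎
    where
    open ≡-Reasoning
    r : ℕ
    r = toℕ (π j ⟨$⟩ˡ x)

  offered-visit : (π : PermSeq n) (j : ℕ) (x : Fin n) → offered π (visit π j x) ≡ x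
  offered-visit π j x = begin
    π (visit π j x / n) ⟨$⟩ʳ fromℕ< (m%n<n (visit π j x) n) ≡⟨ cong₂ (λ k i → π k ⟨$⟩ʳ i) (visit/n≡ π j x) position ⟩
    π j ⟨$⟩ʳ (π j ⟨$⟩ˡ x)                                   ≡⟨ inverseʳ (π j) ⟩
    x                                                       ∎
    where
    open ≡-Reasoning
    position : fromℕ< (m%n<n (visit π j x) n) ≡ π j ⟨$⟩ˡ x
    position = toℕ-injective (begin
      toℕ (fromℕ< (m%n<n (visit π j x) n)) ≡⟨ toℕ-fromℕ< _ ⟩
      visit π j x % n                     ≡⟨ [m+kn]%n≡m%n _ j n ⟩
      toℕ (π j ⟨$⟩ˡ x) % n                 ≡⟨ m<n⇒m%n≡m (toℕ<n (π j ⟨$⟩ˡ x)) ⟩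
      toℕ (π j ⟨$⟩ˡ x)                     ∎)

  visit<suc*n : (π : PermSeq n) (j : ℕ) (x : Fin n) → visit π j x < suc j * n
  visit<suc*n π j x = +-monoˡ-< (j * n) (toℕ<n (π j ⟨$⟩ˡ x))

  -- During the j-th permutation Builder joins the offered v to its j-th out-neighbour; the fallback
  -- v (a loop) is only chosen once the out-list of v is exhausted.
  followOut : (Fin n → List (Fin n)) → Strategy n
  followOut out h v = nthOr v (out v) (length h / n)

  orientation⇒LabWithinSurely : (G : Graph n) (d : ℕ) → Orientation d G ⊤ → LabWithinSurely G (d * n)
  orientation⇒LabWithinSurely G d o = strategy , λ π x y xy → [ inj₁ ∘ built π , inj₂ ∘ built π ]′ (covers ∈⊤ ∈⊤ xy)
    where
    open Orientation o
    strategy : Strategy n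
    strategy = followOut out
    built : (π : PermSeq n) {x y : Fin n} → y ∈ out x → (x , y) ∈ history strategy π (d * n)
    built π {x} {y} y∈out with j , j<len , nth≡y ← ∈⇒nthOr {d = x} y∈out =
      ∈-history-mono strategy π (≤⇒≤′ (begin
        suc i        ≤⟨ visit<suc*n π j x ⟩
        suc j * n    ≤⟨ *-monoˡ-≤ n (≤-trans j<len (out-length x)) ⟩
        d * n        ∎))
      (here (cong₂ _,_ (sym (offered-visit π j x)) (sym chosen)))
      where
      open ≤-Reasoning
      i : ℕ
      i = visit π j x
      chosen : strategy (history strategy π i) (offered π i) ≡ y
      chosen rewrite offered-visit π j x | length-history strategy π i | visit/n≡ π j x = nth≡y

  degenerate⇒LabWithinSurely : (G : Graph n) (d : ℕ) → Degenerate d G → LabWithinSurely G (d * n)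
  degenerate⇒LabWithinSurely G d degenerate =
    orientation⇒LabWithinSurely G d (degenerate⇒orientation G degenerate ⊤)

least : {P : ℕ → Set} → Decidable P → ∀ {N} → P N → ∃ λ m → P m × (∀ {k} → P k → m ≤ k)
least P? {zero} p0 = 0 , p0 , λ _ → z≤n
least {P} P? {suc N} pN with P? 0
... | yes p0 = 0 , p0 , λ _ → z≤n
... | no ¬p0 with m , pm , minimal ← least (P? ∘ suc) pN = suc m , pm , minimal′
  where
  minimal′ : ∀ {k} → P k → suc m ≤ k
  minimal′ {zero}  p0 = ⊥-elim (¬p0 p0)
  minimal′ {suc k} pk = s≤s (minimal pk)

module BreadthFirst {n : ℕ} (G : Graph n) (r : Fin n) (connected : Connected G) where

  WalkOfLength : ℕ → Fin n → Set
  WalkOfLength zero    v = v ≡ r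
  WalkOfLength (suc k) v = ∃ λ y → adj G v y ≡ true × WalkOfLength k y

  walkOfLength? : ∀ k → Decidable (WalkOfLength k)
  walkOfLength? zero    v = v ≟ r
  walkOfLength? (suc k) v = any? λ y → (adj G v y Bool.≟ true) ×-dec walkOfLength? k y

  walk⇒WalkOfLength : ∀ {v} → Walk G v r → ∃ λ k → WalkOfLength k v
  walk⇒WalkOfLength here = 0 , refl
  walk⇒WalkOfLength (step {y = y} vy w) with k , wk ← walk⇒WalkOfLength w = suc k , y , vy , wk

  nearest : ∀ v → ∃ λ m → WalkOfLength m v × (∀ {k} → WalkOfLength k v → m ≤ k)
  nearest v = least (λ k → walkOfLength? k v) (proj₂ (walk⇒WalkOfLength (connected v r)))

  dist : Fin n → ℕ
  dist v = proj₁ (nearest v)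

  parent : ∀ v → v ≢ r → ∃ λ y → adj G v y ≡ true × dist y < dist v
  parent v v≢r with nearest v
  ... | zero  , v≡r          , _ = ⊥-elim (v≢r v≡r)
  ... | suc k , (y , vy , wk) , _ = y , vy , s≤s (proj₂ (proj₂ (nearest y)) wk)

  parentEdge : Fin n → Maybe (Fin n × Fin n)
  parentEdge v with v ≟ r
  ... | yes _   = nothing
  ... | no  v≢r = just (sortPair (v , proj₁ (parent v v≢r)))

  parentEdge-∈ : ∀ v → parentEdge v ∈ nothing ∷ map just (edges G)
  parentEdge-∈ v with v ≟ r
  ... | yes _   = here refl
  ... | no  v≢r = there (∈-map⁺ just (sortPair-∈-edges G (proj₁ (proj₂ (parent v v≢r)))))

  parentEdge-injective : ∀ v w → parentEdge v ≡ parentEdge w → v ≡ w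
  parentEdge-injective v w eq with v ≟ r | w ≟ r
  ... | yes v≡r | yes w≡r = trans v≡r (sym w≡r)
  ... | yes _   | no  _   with () ← eq
  ... | no  _   | yes _   with () ← eq
  ... | no  v≢r | no  w≢r with sortPair-injective _ _ (just-injective eq)
  ...   | inj₁ same    = cong proj₁ same
  ...   | inj₂ swapped = ⊥-elim (<-asym
    (subst (λ u → dist u < dist v) (cong proj₂ swapped) (proj₂ (proj₂ (parent v v≢r))))
    (subst (λ u → dist u < dist w) (sym (cong proj₁ swapped)) (proj₂ (proj₂ (parent w w≢r)))))

connected⇒n≤1+e : ∀ {n} (G : Graph n) → Connected G → n ≤ suc (e G)
connected⇒n≤1+e {zero}  G _         = z≤n
connected⇒n≤1+e {suc n} G connected = begin
  suc n                                 ≡⟨ length-tabulate {n = suc n} (λ x → x) ⟨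
  length (allFin (suc n))               ≤⟨ length-≤-injection parentEdge (allFin⁺ (suc n))
                                             (λ {v} _ → parentEdge-∈ v) (λ {v} {w} _ _ → parentEdge-injective v w) ⟩
  length (nothing ∷ map just (edges G)) ≡⟨ cong suc (length-map just (edges G)) ⟩
  suc (length (edges G))                ≡⟨ cong suc (e≡length-edges G) ⟨
  suc (e G)                             ∎
  where
  open ≤-Reasoning
  open BreadthFirst G Data.Fin.zero connected using (parentEdge; parentEdge-∈; parentEdge-injective)

module _ {n : ℕ} (G : Graph n) where

  AdjChain-++⁻ˡ : ∀ xs {ys} → AdjChain G (xs ++ ys) → AdjChain G xs
  AdjChain-++⁻ˡ []           _              = tt
  AdjChain-++⁻ˡ (x ∷ [])     _              = tt
  AdjChain-++⁻ˡ (x ∷ y ∷ xs) (xy , chain)   = xy , AdjChain-++⁻ˡ (y ∷ xs) chain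

  AdjChain-∷ʳ : ∀ xs z {w} → AdjChain G (xs ∷ʳ z) → adj G z w ≡ true → AdjChain G (xs ∷ʳ z ∷ʳ w)
  AdjChain-∷ʳ []           z _            zw = zw , tt
  AdjChain-∷ʳ (x ∷ [])     z (xz , _)     zw = xz , zw , tt
  AdjChain-∷ʳ (x ∷ y ∷ xs) z (xy , chain) zw = xy , AdjChain-∷ʳ (y ∷ xs) z chain zw

  open DecMembership (_≟_ {n}) using (_∈?_)

  module _ (S : Subset n) (degree≥2 : ∀ {v} → v ∈ₛ S → 2 ≤ degIn G S v) where

    another-neighbour : ∀ {h} → h ∈ₛ S → ∀ w → ∃ λ z → z ∈ neighbours G S h × z ≢ w
    another-neighbour {h} h∈S = Unique⇒∃≢ _≟_ (neighbours-unique G S h)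
      (subst (2 ≤_) (degIn≡length-neighbours G S h) (degree≥2 h∈S))

    closed-path⇒cycle : ∀ h t → h ∈ₛ S → Unique (h ∷ t) → AdjChain G (h ∷ t) →
      All (_∈ h ∷ t) (neighbours G S h) → HasCycle G
    closed-path⇒cycle h [] h∈S _ _ closed with z , z∈ , _ ← another-neighbour h∈S h
      with All.lookup closed z∈
    ... | here refl = ⊥-elim (∉-neighbours-self G S z∈)
    closed-path⇒cycle h (s ∷ t) h∈S uniq chain closed
      with z , z∈ , z≢s ← another-neighbour h∈S s | All.lookup closed z∈
    ... | here refl = ⊥-elim (∉-neighbours-self G S z∈)
    ... | there (here refl) = ⊥-elim (z≢s refl)
    ... | there (there z∈t) with a , b , refl ← ∈-∃++ z∈t =
      h , s ∷ a ∷ʳ z , s≤s (length-∷ʳ≥1 a z) ,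
      Unique-++⁻ˡ (h ∷ s ∷ a ∷ʳ z) (subst Unique path≡ uniq) ,
      AdjChain-∷ʳ (h ∷ s ∷ a) z (AdjChain-++⁻ˡ (h ∷ s ∷ a ∷ʳ z) (subst (AdjChain G) path≡ chain))
        (trans (adj-sym G z h) (proj₂ (∈-neighbours⁻ G {S} z∈)))
      where
      path≡ : h ∷ s ∷ a ++ z ∷ b ≡ h ∷ s ∷ (a ∷ʳ z) ++ b
      path≡ = cong (λ l → h ∷ s ∷ l) (sym (++-assoc a [ z ] b))

    -- Grow a path from its head h while h has a neighbour off the path; since a path has at most
    -- n vertices, after n steps the head's neighbours all lie on the path.
    path⇒cycle : (k : ℕ) (h : Fin n) (t : List (Fin n)) → h ∈ₛ S → Unique (h ∷ t) → AdjChain G (h ∷ t) →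
      n < length (h ∷ t) + k → HasCycle G
    path⇒cycle zero h t _ uniq _ n<len = ⊥-elim (<⇒≱ n<len (subst (_≤ n) (sym (+-identityʳ _)) (Unique⇒length≤ uniq)))
    path⇒cycle (suc k) h t h∈S uniq chain n<len with all? (_∈? h ∷ t) (neighbours G S h)
    ... | yes closed = closed-path⇒cycle h t h∈S uniq chain closed
    ... | no ¬closed =
      let y , y∈ , y∉ = find (¬All⇒Any¬ (_∈? h ∷ t) _ ¬closed)
          y∈S , hy     = ∈-neighbours⁻ G {S} y∈
      in path⇒cycle k y (h ∷ t) y∈S (¬Any⇒All¬ (h ∷ t) y∉ ∷ uniq) (trans (adj-sym G y h) hy , chain)
           (subst (n <_) (+-suc (length (h ∷ t)) k) n<len)

  acyclic⇒1-degenerate : ¬ HasCycle G → Degenerate 1 G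
  acyclic⇒1-degenerate acyclic S (v , v∈S) with any? (λ v → (v ∈ₛ? S) ×-dec (degIn G S v ≤? 1))
  ... | yes (u , u∈S , deg≤1) = u , u∈S , deg≤1
  ... | no none = ⊥-elim (acyclic (path⇒cycle S degree≥2 n v [] v∈S ([] ∷ []) tt (n<1+n n)))
    where
    degree≥2 : ∀ {u} → u ∈ₛ S → 2 ≤ degIn G S u
    degree≥2 {u} u∈S = ≰⇒> λ deg≤1 → none (u , u∈S , deg≤1)

corollary3p5 : (n : ℕ) .{{_ : NonZero n}} →
    ((G : Graph n) (d : ℕ) → Degenerate d G →
        ((k : ℕ) → k < e G → CopyWithinNever G k)
      × LabWithinSurely G (d * n)
      × (e G ≡ d * n →
            ((k : ℕ) → k < d * n → CopyWithinNever G k)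
          × LabWithinSurely G (d * n)))
    × ((T : Graph n) → IsTree T →
        ((k : ℕ) → k < n ∸ 1 → CopyWithinNever T k)
      × LabWithinSurely T n)
corollary3p5 n =
    (λ G d degenerate →
         <e⇒CopyWithinNever G
       , degenerate⇒LabWithinSurely G d degenerate
       , λ e≡dn → (λ k k<dn → <e⇒CopyWithinNever G k (subst (k <_) (sym e≡dn) k<dn))
                , degenerate⇒LabWithinSurely G d degenerate)
  , λ T (connected , acyclic) →
         (λ k k<n∸1 → <e⇒CopyWithinNever T k (<-≤-trans k<n∸1 (∸-monoˡ-≤ 1 (connected⇒n≤1+e T connected))))
       , subst (LabWithinSurely T) (*-identityˡ n) (degenerate⇒LabWithinSurely T 1 (acyclic⇒1-degenerate T acyclic))
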